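{- Let $(S,\prec,\lhd)$ be a Burling set such that the graph $(S,E_\lhd)$ is connected. Then $(S,\prec,\lhd)$ has a unique root.
   Context: A Burling set is a triple $(S,\prec,\lhd)$ where $S$ is a non-empty finite set, $\prec$ is a strict partial order on $S$, $\lhd$ is an acyclic relation on $S$, and for all $x,y,z\in S$: (A1) if $x\prec y$, $x\prec z$, $y\ne z$, then $y\prec z$ or $z\prec y$; (A2) if $x\lhd y$, $x\lhd z$, $y\neq z$, then $y\prec z$ or $z\prec y$; (A3) if $x\lhd y$ and $x\prec z$, then $y\prec z$; (A4) if $x\lhd y$ and $y\prec z$, then $x\lhd z$ or $x\prec z$. The graph $(S,E_\lhd)$ has vertex set $S$ and edges $xy$ for $x\lhd y$. A root of $(S,\prec,\lhd)$ is an element $s\in S$ such that there is no $x\in S$ with $s\prec x$ or $s\lhd x$. -}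

module Defs where

open import Data.Nat using (ℕ)
open import Data.Fin using (Fin)
open import Data.Bool using (Bool; true)
open import Data.Product using (_×_; ∃; ∃!)
open import Data.Sum using (_⊎_)
open import Data.Empty using (⊥)
open import Relation.Nullary using (¬_)
open import Relation.Binary.PropositionalEquality using (_≡_; _≢_)
open import Relation.Binary.Construct.Closure.Transitive using (TransClosure)
open import Relation.Binary.Construct.Closure.ReflexiveTransitive using (Star)

-- A finite set is modelled as Fin n; relations on a finite set are given
-- by Boolean-valued (i.e. decidable) functions, which loses no generality
-- for finite sets classically.
BRel : ℕ → Set
BRel n = Fin n → Fin n → Bool

holds : ∀ {n} → BRel n → Fin n → Fin n → Set
holds R x y = R x y ≡ true

IsStrictPartialOrder : ∀ {n} → BRel n → Set
IsStrictPartialOrder {n} P =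
  (∀ (x : Fin n) → ¬ holds P x x) ×
  (∀ (x y z : Fin n) → holds P x y → holds P y z → holds P x z)

IsAcyclic : ∀ {n} → BRel n → Set
IsAcyclic {n} L = ∀ (x : Fin n) → ¬ TransClosure (holds L) x x

record IsBurlingSet {n : ℕ} (P L : BRel n) : Set where
  field
    spo     : IsStrictPartialOrder P
    acyclic : IsAcyclic L
    A1 : ∀ x y z → holds P x y → holds P x z → y ≢ z → holds P y z ⊎ holds P z y
    A2 : ∀ x y z → holds L x y → holds L x z → y ≢ z → holds P y z ⊎ holds P z y
    A3 : ∀ x y z → holds L x y → holds P x z → holds P y z
    A4 : ∀ x y z → holds L x y → holds P y z → holds L x z ⊎ holds P x z

Edge : ∀ {n} → BRel n → Fin n → Fin n → Set
Edge L x y = holds L x y ⊎ holds L y x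

Connected : ∀ {n} → BRel n → Set
Connected {n} L = ∀ (x y : Fin n) → Star (Edge L) x y

IsRoot : ∀ {n} → BRel n → BRel n → Fin n → Set
IsRoot {n} P L s = ∀ (x : Fin n) → ¬ holds P s x × ¬ holds L s x

-- The steps x ≺ y and x ◁ y together form a relation ↝ which is acyclic: by A4, any ↝-path
-- can be rewritten as a single ↝-step followed by ◁-steps, and such a path cannot close up
-- because ◁ is acyclic and ≺ is irreflexive.  On a finite set every element therefore
-- ↝-reaches a root.  By A1–A3 any two ↝-successors of an element are ≺-comparable, so two
-- ↝-paths from the same element can always be merged, and the root it reaches is unique.
-- Both ends of a ◁-edge then reach the same root, and connectedness makes it global.
module Submission where

open import Defs
open import Level using (Level; _⊔_)
open import Data.Nat using (ℕ; suc)
open import Data.Fin using (Fin; zero)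
open import Data.Fin.Properties using (any?; _≟_)
open import Data.Fin.Induction using (spo-noetherian)
open import Data.Bool using (true)
import Data.Bool as Bool
open import Data.Product using (∃; ∃!; _×_; _,_; proj₁; proj₂)
open import Data.Sum using (_⊎_; inj₁; inj₂; swap; map)
open import Data.Empty using (⊥-elim)
open import Function using (flip)
open import Relation.Nullary using (¬_; Dec; yes; no)
open import Relation.Nullary.Decidable using (_⊎-dec_)
open import Relation.Binary.Core using (Rel)
open import Relation.Binary.Definitions using (DecidableEquality)
import Relation.Binary.Structures as Structures
open import Relation.Binary.PropositionalEquality
  using (_≡_; _≢_; refl; sym; subst; isEquivalence)
open import Relation.Binary.Construct.Closure.Transitive using (TransClosure; [_]; _∷_; _++_)
open import Relation.Binary.Construct.Closure.ReflexiveTransitive using (Star; ε; _◅_)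
open import Induction.WellFounded using (Acc; acc; WellFounded; module Subrelation)

Terminal : ∀ {a ℓ} {A : Set a} → Rel A ℓ → A → Set (a ⊔ ℓ)
Terminal _⟶_ t = ∀ y → ¬ (t ⟶ y)

module _ {a ℓ : Level} {A : Set a} {_⟶_ : Rel A ℓ} where

  ⟶◅⟶*⇒⟶⁺ : ∀ {x y z} → x ⟶ y → Star _⟶_ y z → TransClosure _⟶_ x z
  ⟶◅⟶*⇒⟶⁺ r ε        = [ r ]
  ⟶◅⟶*⇒⟶⁺ r (s ◅ ss) = r ∷ ⟶◅⟶*⇒⟶⁺ s ss

  terminal-⟶*⇒≡ : ∀ {t u} → Terminal _⟶_ t → Star _⟶_ t u → t ≡ u
  terminal-⟶*⇒≡ t-term ε       = refl
  terminal-⟶*⇒≡ t-term (r ◅ _) = ⊥-elim (t-term _ r)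

  reachesTerminal : (∀ x → Dec (∃ (x ⟶_))) →
                    ∀ {x} → Acc (flip _⟶_) x → ∃ λ t → Terminal _⟶_ t × Star _⟶_ x t
  reachesTerminal step? {x} (acc rs) with step? x
  ... | no  stuck = x , (λ y r → stuck (y , r)) , ε
  ... | yes (y , r) with reachesTerminal step? (rs r)
  ...   | t , t-term , path = t , t-term , r ◅ path

  reachedTerminal-unique :
    DecidableEquality A →
    (∀ {x y z} → x ⟶ y → x ⟶ z → y ≢ z → y ⟶ z ⊎ z ⟶ y) →
    ∀ {x t₁ t₂} → Acc (flip _⟶_) x → Star _⟶_ x t₁ → Star _⟶_ x t₂ →
    Terminal _⟶_ t₁ → Terminal _⟶_ t₂ → t₁ ≡ t₂
  reachedTerminal-unique _≟_ diverge = go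
    where
    go : ∀ {x t₁ t₂} → Acc (flip _⟶_) x → Star _⟶_ x t₁ → Star _⟶_ x t₂ →
         Terminal _⟶_ t₁ → Terminal _⟶_ t₂ → t₁ ≡ t₂
    go _ ε p₂ t₁-term _ = terminal-⟶*⇒≡ t₁-term p₂
    go _ p₁ ε _ t₂-term = sym (terminal-⟶*⇒≡ t₂-term p₁)
    go (acc rs) (_◅_ {j = y} xy p₁) (_◅_ {j = z} xz p₂) t₁-term t₂-term with y ≟ z
    ... | yes refl = go (rs xy) p₁ p₂ t₁-term t₂-term
    ... | no y≢z with diverge xy xz y≢z
    ...   | inj₁ yz = go (rs xy) p₁ (yz ◅ p₂) t₁-term t₂-term
    ...   | inj₂ zy = go (rs xz) (zy ◅ p₁) p₂ t₁-term t₂-term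

module BurlingSet {n : ℕ} {P L : BRel n} (B : IsBurlingSet P L) where
  open IsBurlingSet B

  _≺_ _◁_ _↝_ : Rel (Fin n) _
  x ≺ y = holds P x y
  x ◁ y = holds L x y
  x ↝ y = x ≺ y ⊎ x ◁ y

  _◁⁺_ _◁*_ _↝⁺_ _↝*_ : Rel (Fin n) _
  _◁⁺_ = TransClosure _◁_
  _◁*_ = Star _◁_
  _↝⁺_ = TransClosure _↝_
  _↝*_ = Star _↝_

  ≺-irrefl : ∀ x → ¬ x ≺ x
  ≺-irrefl = proj₁ spo

  ≺-trans : ∀ {x y z} → x ≺ y → y ≺ z → x ≺ z
  ≺-trans = proj₂ spo _ _ _

  ◁*≺⇒◁⁺⊎≺ : ∀ {x y z} → x ◁* y → y ≺ z → x ◁⁺ z ⊎ x ≺ z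
  ◁*≺⇒◁⁺⊎≺ ε y≺z = inj₂ y≺z
  ◁*≺⇒◁⁺⊎≺ {x} {z = z} (_◅_ {j = w} x◁w w◁*y) y≺z with ◁*≺⇒◁⁺⊎≺ w◁*y y≺z
  ... | inj₁ w◁⁺z = inj₁ (x◁w ∷ w◁⁺z)
  ... | inj₂ w≺z with A4 x w z x◁w w≺z
  ...   | inj₁ x◁z = inj₁ [ x◁z ]
  ...   | inj₂ x≺z = inj₂ x≺z

  ↝◅↝◁* : ∀ {x y w} → x ↝ y → (∃ λ z → y ↝ z × z ◁* w) → ∃ λ z → x ↝ z × z ◁* w
  ↝◅↝◁* {y = y} x↝y (z , inj₂ y◁z , z◁*w) = y , x↝y , y◁z ◅ z◁*w
  ↝◅↝◁* (inj₁ x≺y) (z , inj₁ y≺z , z◁*w) = z , inj₁ (≺-trans x≺y y≺z) , z◁*w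
  ↝◅↝◁* {x} {y} (inj₂ x◁y) (z , inj₁ y≺z , z◁*w) = z , swap (A4 x y z x◁y y≺z) , z◁*w

  ↝⁺⇒↝◁* : ∀ {x y} → x ↝⁺ y → ∃ λ z → x ↝ z × z ◁* y
  ↝⁺⇒↝◁* [ x↝y ]      = _ , x↝y , ε
  ↝⁺⇒↝◁* (x↝y ∷ y↝⁺w) = ↝◅↝◁* x↝y (↝⁺⇒↝◁* y↝⁺w)

  ↝⁺-irrefl : ∀ x → ¬ x ↝⁺ x
  ↝⁺-irrefl x x↝⁺x with ↝⁺⇒↝◁* x↝⁺x
  ... | z , inj₂ x◁z , z◁*x = acyclic x (⟶◅⟶*⇒⟶⁺ x◁z z◁*x)
  ... | z , inj₁ x≺z , z◁*x with ◁*≺⇒◁⁺⊎≺ z◁*x x≺z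
  ...   | inj₁ z◁⁺z = acyclic z z◁⁺z
  ...   | inj₂ z≺z  = ≺-irrefl z z≺z

  ↝⁺-isStrictPartialOrder : Structures.IsStrictPartialOrder _≡_ _↝⁺_
  ↝⁺-isStrictPartialOrder = record
    { isEquivalence = isEquivalence
    ; irrefl        = λ { {x} refl → ↝⁺-irrefl x }
    ; trans         = _++_
    ; <-resp-≈      = (λ { refl r → r }) , (λ { refl r → r })
    }

  ↝-noetherian : WellFounded (flip _↝_)
  ↝-noetherian = Subrelation.wellFounded [_] (spo-noetherian ↝⁺-isStrictPartialOrder)

  ↝-diverge : ∀ {x y z} → x ↝ y → x ↝ z → y ≢ z → y ↝ z ⊎ z ↝ y
  ↝-diverge {x} {y} {z} x↝y x↝z y≢z = map inj₁ inj₁ (comparable x↝y x↝z)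
    where
    comparable : x ↝ y → x ↝ z → y ≺ z ⊎ z ≺ y
    comparable (inj₁ x≺y) (inj₁ x≺z) = A1 x y z x≺y x≺z y≢z
    comparable (inj₂ x◁y) (inj₂ x◁z) = A2 x y z x◁y x◁z y≢z
    comparable (inj₂ x◁y) (inj₁ x≺z) = inj₁ (A3 x y z x◁y x≺z)
    comparable (inj₁ x≺y) (inj₂ x◁z) = inj₂ (A3 x z y x◁z x≺y)

  ↝-step? : ∀ x → Dec (∃ (x ↝_))
  ↝-step? x = any? λ y → (P x y Bool.≟ true) ⊎-dec (L x y Bool.≟ true)

  root⇒terminal : ∀ {r} → IsRoot P L r → Terminal _↝_ r
  root⇒terminal r-root y (inj₁ r≺y) = proj₁ (r-root y) r≺y
  root⇒terminal r-root y (inj₂ r◁y) = proj₂ (r-root y) r◁y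

  terminal⇒root : ∀ {r} → Terminal _↝_ r → IsRoot P L r
  terminal⇒root r-term y = (λ r≺y → r-term y (inj₁ r≺y)) , (λ r◁y → r-term y (inj₂ r◁y))

  reachesRoot : ∀ x → ∃ λ r → Terminal _↝_ r × x ↝* r
  reachesRoot x = reachesTerminal ↝-step? (↝-noetherian x)

  reachedRoot-unique : ∀ {x r₁ r₂} → x ↝* r₁ → x ↝* r₂ →
                       Terminal _↝_ r₁ → Terminal _↝_ r₂ → r₁ ≡ r₂
  reachedRoot-unique = reachedTerminal-unique _≟_ ↝-diverge (↝-noetherian _)

  reachesRoot-along-edge : ∀ {x y r} → Terminal _↝_ r → Edge L x y → x ↝* r → y ↝* r
  reachesRoot-along-edge r-term (inj₂ y◁x) x↝*r = inj₂ y◁x ◅ x↝*r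
  reachesRoot-along-edge {y = y} r-term (inj₁ x◁y) x↝*r with reachesRoot y
  ... | r′ , r′-term , y↝*r′ =
    subst (y ↝*_) (reachedRoot-unique (inj₂ x◁y ◅ y↝*r′) x↝*r r′-term r-term) y↝*r′

  reachesRoot-along-walk : ∀ {x y r} → Terminal _↝_ r → Star (Edge L) x y → x ↝* r → y ↝* r
  reachesRoot-along-walk r-term ε        x↝*r = x↝*r
  reachesRoot-along-walk r-term (e ◅ es) x↝*r =
    reachesRoot-along-walk r-term es (reachesRoot-along-edge r-term e x↝*r)

  unique-root : Fin n → Connected L → ∃! _≡_ (IsRoot P L)
  unique-root x connected with reachesRoot x
  ... | r , r-term , x↝*r =
    r , terminal⇒root r-term ,
    λ {s} s-root → sym (terminal-⟶*⇒≡ (root⇒terminal s-root)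
                          (reachesRoot-along-walk r-term (connected x s) x↝*r))

mainTheorem7 : ∀ (n : ℕ) (P L : BRel (suc n)) →
    IsBurlingSet P L → Connected L → ∃! _≡_ (IsRoot P L)
mainTheorem7 n P L B connected = BurlingSet.unique-root B zero connected
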